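{- Let $\mathfrak{g}$ be of type $E_6^{(1)}$ and $s\ge1$. Let $\alpha = \alpha_1 + \alpha_2 + 2\alpha_3 + 2\alpha_4 + \alpha_5 = \Lambda_3-\Lambda_6$. Then the highest weight rigged configurations of $B^{3,s}$ are exactly $\nu(k\ast[\alpha])$, $0\le k\le s$, with all riggings $0$; the one indexed by $k$ has weight $(s-k)\Lambda_3+k\Lambda_6$ and cocharge $k$. Consequently \[ \mathrm{RC}(B^{3,s}) = \bigoplus_{k=0}^s \mathrm{RC}(B^{3,s}; (s-k)\Lambda_3 + k\Lambda_6). \]
   Context: Finite type $E_6$ with Bourbaki labeling: edges $1$–$3$, $3$–$4$, $4$–$5$, $5$–$6$, $2$–$4$; $I_0=\{1,\dots,6\}$, Cartan matrix $(A_{ab})$, simple roots $\alpha_a$, fundamental weights $\Lambda_a$. Rigged configurations for $B^{r,s}$: a configuration $\nu=(\nu^{(a)})_{a\in I_0}$ is a tuple of partitions, $m_i^{(a)}$ the number of rows of length $i$ in $\nu^{(a)}$. Vacancy numbers: $p_i^{(a)} = \delta_{ar}\min(i,s) - \sum_{b\in I_0}A_{ab}\sum_{j\ge1}\min(i,j)m_j^{(b)}$. A rigged configuration $(\nu,J)$ assigns to each row of $\nu^{(a)}$ of length $i$ an integer rigging $x\le p_i^{(a)}$ (a multiset for rows of equal length); it is highest weight if all riggings are $\ge 0$. Weight: $s\Lambda_r-\sum_a|\nu^{(a)}|\alpha_a$. Cocharge: $\mathrm{cc}(\nu,J)=\frac12\sum_{a,b\in I_0}\sum_{i,j}A_{ab}\min(i,j)m_i^{(a)}m_j^{(b)}+\sum(\text{all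 riggings})$. $\mathrm{RC}(B^{r,s})$ is a $U_q(\mathfrak{g}_0)$-crystal whose highest weight elements are the highest weight rigged configurations, each of weight $\lambda$ generating a component isomorphic to $B(\lambda)$; $\mathrm{RC}(B^{r,s};\lambda)$ is the union of components with highest weight $\lambda$. For $\beta^{(k)}=\sum_a c_a^{(k)}\alpha_a$ with $c_a^{(k)}\in\mathbb{Z}_{\ge0}$, $\nu(\beta^{(1)},\dots,\beta^{(\ell)})$ is the configuration in which $\nu^{(a)}$ has columns of heights $c_a^{(1)},\dots,c_a^{(\ell)}$ (sorted, zeros omitted); $k\ast[\beta]$ is $k$ copies of $\beta$. -}

module Defs where

open import Data.Nat as ℕ using (ℕ; zero; suc)
open import Data.Integer as ℤ using (ℤ; +_; _+_; _-_; _*_; _≤_; _/ℕ_)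
open import Data.Fin using (Fin; zero; suc; _≟_)
open import Relation.Nullary using (yes; no)
open import Data.Product using (_×_; _,_; proj₁; proj₂)
open import Data.List using (List; []; _∷_; map; replicate; allFin; foldr)
open import Data.List.Relation.Unary.All using (All)
open import Data.List.Relation.Binary.Permutation.Propositional using (_↭_)
open import Relation.Binary.PropositionalEquality using (_≡_)

-- Node set I₀ = {1,…,6} of E₆ (Bourbaki labels); Fin 6 index i stands for node i+1.
I₀ : Set
I₀ = Fin 6

node3 node6 : I₀
node3 = suc (suc zero)
node6 = suc (suc (suc (suc (suc zero))))

-- Cartan matrix of E₆, Bourbaki labelling: edges 1–3, 3–4, 4–5, 5–6, 2–4.
cartan : I₀ → I₀ → ℤ
cartan zero zero = + 2
cartan zero (suc (suc zero)) = ℤ.-1ℤ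
cartan (suc zero) (suc zero) = + 2
cartan (suc zero) (suc (suc (suc zero))) = ℤ.-1ℤ
cartan (suc (suc zero)) zero = ℤ.-1ℤ
cartan (suc (suc zero)) (suc (suc zero)) = + 2
cartan (suc (suc zero)) (suc (suc (suc zero))) = ℤ.-1ℤ
cartan (suc (suc (suc zero))) (suc zero) = ℤ.-1ℤ
cartan (suc (suc (suc zero))) (suc (suc zero)) = ℤ.-1ℤ
cartan (suc (suc (suc zero))) (suc (suc (suc zero))) = + 2
cartan (suc (suc (suc zero))) (suc (suc (suc (suc zero)))) = ℤ.-1ℤ
cartan (suc (suc (suc (suc zero)))) (suc (suc (suc zero))) = ℤ.-1ℤ
cartan (suc (suc (suc (suc zero)))) (suc (suc (suc (suc zero)))) = + 2
cartan (suc (suc (suc (suc zero)))) (suc (suc (suc (suc (suc zero))))) = ℤ.-1ℤ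
cartan (suc (suc (suc (suc (suc zero))))) (suc (suc (suc (suc zero)))) = ℤ.-1ℤ
cartan (suc (suc (suc (suc (suc zero))))) (suc (suc (suc (suc (suc zero))))) = + 2
cartan _ _ = + 0

sum : List ℤ → ℤ
sum = foldr _+_ (+ 0)

δ : I₀ → I₀ → ℤ
δ a b with a ≟ b
... | yes _ = + 1
... | no _ = + 0

Σ₆ : (I₀ → ℤ) → ℤ
Σ₆ f = sum (map f (allFin 6))

-- A row of ν^(a) together with its rigging: (row length i, rigging x).
Row : Set
Row = ℕ × ℤ

-- A rigged configuration: for each a ∈ I₀, the multiset of rigged rows of
-- ν^(a), represented as a list; two lists represent the same rigged
-- configuration iff they are permutations of each other (see _≈RC_).
RC : Set
RC = I₀ → List Row

_≈RC_ : RC → RC → Set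
rc ≈RC rc' = ∀ a → rc a ↭ rc' a

-- Σ_{j ≥ 1} min(i,j) m_j^(b), computed over the rows of ν^(b).
Q : ℕ → List Row → ℤ
Q i rows = sum (map (λ row → + (ℕ._⊓_ i (proj₁ row))) rows)

vacancy : (s : ℕ) → RC → I₀ → ℕ → ℤ
vacancy s rc a i = δ a node3 * + (ℕ._⊓_ i s) - Σ₆ (λ b → cartan a b * Q i (rc b))

IsRC : ℕ → RC → Set
IsRC s rc = ∀ a → All (λ row → (1 ℕ.≤ proj₁ row) × (proj₂ row ≤ vacancy s rc a (proj₁ row))) (rc a)

IsHWRC : ℕ → RC → Set
IsHWRC s rc = IsRC s rc × (∀ a → All (λ row → + 0 ≤ proj₂ row) (rc a))

size : List Row → ℤ
size rows = sum (map (λ row → + proj₁ row) rows)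

-- Weight s Λ₃ − Σ_a |ν^(a)| α_a, written in the basis of fundamental weights:
-- the Λ_b-coefficient (using α_a = Σ_b A_{ba} Λ_b).
weight : ℕ → RC → I₀ → ℤ
weight s rc b = δ b node3 * + s - Σ₆ (λ a → cartan b a * size (rc a))

-- Σ_{i,j} min(i,j) m_i^(a) m_j^(b), computed over pairs of rows.
pairSum : List Row → List Row → ℤ
pairSum xs ys = sum (map (λ r → Q (proj₁ r) ys) xs)

cocharge : RC → ℤ
cocharge rc =
  (Σ₆ (λ a → Σ₆ (λ b → cartan a b * pairSum (rc a) (rc b)))) /ℕ 2
  + Σ₆ (λ a → sum (map proj₂ (rc a)))

cα : I₀ → ℕ
cα zero = 1
cα (suc zero) = 1
cα (suc (suc zero)) = 2
cα (suc (suc (suc zero))) = 2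
cα (suc (suc (suc (suc zero)))) = 1
cα (suc (suc (suc (suc (suc zero))))) = 0

-- ν(k ∗ [α]) with all riggings 0: ν^(a) has k columns of height cα a,
-- i.e. cα a rows of length k (empty when k = 0).
νkα : ℕ → RC
νkα zero a = []
νkα (suc k) a = replicate (cα a) (suc k , + 0)

targetWeight : ℕ → ℕ → I₀ → ℤ
targetWeight s k b = δ b node3 * (+ s - + k) + δ b node6 * + k

module Submission where

-- Write h_t for the vector of heights of the t-th columns of ν^(1), …, ν^(6).
-- The vacancy number p_i^(a) is the sum over t ≤ i of the jumps
-- Δ_t^(a) = δ_{a3}[t ≤ s] − (A h_t)_a, so summing p over all rows of ν gives
-- Σ_t ([t ≤ s] h_t^(3) − h_tᵀ A h_t).  Each column term is ≤ 0 (an explicit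
-- sum-of-squares certificate for A), while for a highest weight rigged
-- configuration the total is ≥ 0, the riggings lying between 0 and the
-- vacancies.  Hence every column term vanishes, which bounds h_t and leaves six
-- possible columns: 0, α, α+α₆, α+α₆+α₅, α+α₆+α₅+α₄, α+α₆+α₅+α₄+α₂.  The last
-- four are excluded one by one, each being the only remaining column with
-- many boxes at some node a, where it makes Δ^(a) = −1: the last such column
-- would end a row of ν^(a) with negative vacancy.  With all columns equal to α
-- up to some k and empty afterwards, ν = ν(k ∗ [α]), and the vacancies
-- k δ_{a6} force the riggings to vanish; weight and cocharge follow from
-- Aα = Λ₃ − Λ₆ and (α, α) = 2.

open import Defs
open import Data.Nat using (ℕ; _≤_)
open import Data.Integer using (+_)
open import Data.Product using (_×_; ∃-syntax)
open import Relation.Binary.PropositionalEquality using (_≡_)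

open import Data.Empty using (⊥-elim)
open import Data.Fin as Fin using (zero; suc)
open import Data.Integer as ℤ using (ℤ; -[1+_]; _+_; _*_; -_; _-_)
open import Data.Integer.DivMod using (_/ℕ_)
import Data.Integer.Properties as ℤP
open import Algebra.Properties.CommutativeSemigroup ℤP.+-commutativeSemigroup using (interchange)
open import Data.Integer.Solver using (module +-*-Solver)
open import Data.Integer.Tactic.RingSolver using (solve-∀)
open import Data.List as List using (List; []; _∷_; map; replicate; length; allFin)
open import Data.List.Membership.Propositional using (_∈_)
open import Data.List.Membership.Propositional.Properties using (∈-allFin)
open import Data.List.Properties using (map-cong; map-replicate)
open import Data.List.Relation.Binary.Permutation.Propositional using (↭-reflexive)
open import Data.List.Relation.Unary.All as All using (All; []; _∷_)
import Data.List.Relation.Unary.All.Properties as AllP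
open import Data.List.Relation.Unary.Any as Any using (Any; here; there)
open import Data.Nat as ℕ using (zero; suc; _<_; _∸_; z≤n; s≤s; _≤′_; ≤′-refl; ≤′-step)
import Data.Nat.DivMod as DivMod
open import Data.Nat.ListAction using () renaming (sum to sumℕ)
import Data.Nat.Properties as ℕP
open import Data.Product using (_,_; proj₁; proj₂)
open import Data.Sum using (_⊎_; inj₁; inj₂)
open import Data.Unit using (tt)
open import Function using (_∘_)
open import Relation.Binary.Definitions using (tri<; tri≈; tri>)
open import Relation.Binary.PropositionalEquality using (refl; sym; trans; cong; cong₂; subst; _≗_; _≢_; module ≡-Reasoning)
open import Relation.Nullary using (Dec; yes; no; ¬_)
import Relation.Nullary.Decidable as Dec
open import Relation.Nullary.Decidable using (True; toWitness; _→-dec_)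
open import Relation.Unary using (Decidable)

sum-map-+ : ∀ {A : Set} (f g : A → ℤ) xs → sum (map (λ x → f x + g x) xs) ≡ sum (map f xs) + sum (map g xs)
sum-map-+ f g []       = refl
sum-map-+ f g (x ∷ xs) = begin
  (f x + g x) + sum (map (λ x → f x + g x) xs) ≡⟨ cong (_+_ (f x + g x)) (sum-map-+ f g xs) ⟩
  (f x + g x) + (sum (map f xs) + sum (map g xs)) ≡⟨ interchange (f x) (g x) _ _ ⟩
  sum (map f (x ∷ xs)) + sum (map g (x ∷ xs))   ∎
  where open ≡-Reasoning

sum-map-*ʳ : ∀ {A : Set} (f : A → ℤ) k xs → sum (map (λ x → f x * k) xs) ≡ sum (map f xs) * k
sum-map-*ʳ f k []       = sym (ℤP.*-zeroˡ k)
sum-map-*ʳ f k (x ∷ xs) =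
  trans (cong (_+_ (f x * k)) (sum-map-*ʳ f k xs)) (sym (ℤP.*-distribʳ-+ k (f x) (sum (map f xs))))

sum-map-nonNeg : ∀ {A : Set} (f : A → ℤ) {xs} → All (λ x → + 0 ℤ.≤ f x) xs → + 0 ℤ.≤ sum (map f xs)
sum-map-nonNeg f []         = ℤP.≤-refl
sum-map-nonNeg f (p ∷ ps) = ℤP.+-mono-≤ p (sum-map-nonNeg f ps)

sum-replicate : ∀ n z → sum (replicate n z) ≡ + n * z
sum-replicate zero    z = refl
sum-replicate (suc n) z = begin
  z + sum (replicate n z) ≡⟨ cong (_+_ z) (sum-replicate n z) ⟩
  z + + n * z             ≡⟨ cong (_+ + n * z) (ℤP.*-identityˡ z) ⟨
  + 1 * z + + n * z       ≡⟨ ℤP.*-distribʳ-+ z (+ 1) (+ n) ⟨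
  + suc n * z             ∎
  where open ≡-Reasoning

∈⇒≤sum : ∀ {A : Set} (f : A → ℕ) {x xs} → x ∈ xs → f x ≤ sumℕ (map f xs)
∈⇒≤sum f (here refl) = ℕP.m≤m+n _ _
∈⇒≤sum f (there x∈xs) = ℕP.≤-trans (∈⇒≤sum f x∈xs) (ℕP.m≤n+m _ _)

Σ₆-cong : ∀ {f g : I₀ → ℤ} → f ≗ g → Σ₆ f ≡ Σ₆ g
Σ₆-cong f≗g = cong sum (map-cong f≗g (allFin 6))

sumTo : ℕ → (ℕ → ℤ) → ℤ
sumTo zero    f = + 0
sumTo (suc n) f = sumTo n f + f (suc n)

sumTo-cong : ∀ n {f g : ℕ → ℤ} → (∀ {t} → 1 ≤ t → t ≤ n → f t ≡ g t) → sumTo n f ≡ sumTo n g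
sumTo-cong zero    f≡g = refl
sumTo-cong (suc n) f≡g =
  cong₂ _+_ (sumTo-cong n (λ 1≤t t≤n → f≡g 1≤t (ℕP.m≤n⇒m≤1+n t≤n))) (f≡g (s≤s z≤n) ℕP.≤-refl)

sumTo-+ : ∀ n (f g : ℕ → ℤ) → sumTo n (λ t → f t + g t) ≡ sumTo n f + sumTo n g
sumTo-+ zero    f g = refl
sumTo-+ (suc n) f g =
  trans (cong (_+ (f (suc n) + g (suc n))) (sumTo-+ n f g)) (interchange (sumTo n f) (sumTo n g) (f (suc n)) (g (suc n)))

sumTo-const : ∀ n z → sumTo n (λ _ → z) ≡ + n * z
sumTo-const zero    z = sym (ℤP.*-zeroˡ z)
sumTo-const (suc n) z = begin
  sumTo n (λ _ → z) + z ≡⟨ cong (_+ z) (sumTo-const n z) ⟩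
  + n * z + z           ≡⟨ cong (_+_ (+ n * z)) (ℤP.*-identityˡ z) ⟨
  + n * z + + 1 * z     ≡⟨ ℤP.*-distribʳ-+ z (+ n) (+ 1) ⟨
  + (n ℕ.+ 1) * z       ≡⟨ cong (λ m → + m * z) (ℕP.+-comm n 1) ⟩
  + suc n * z           ∎
  where open ≡-Reasoning

sumTo-negative : ∀ {u} → 1 ≤ u → sumTo u (λ _ → -[1+ 0 ]) ℤ.< + 0
sumTo-negative {suc k} _ = subst (ℤ._< + 0) (sym (sumTo-const (suc k) -[1+ 0 ])) ℤ.-<+

Σ₆-sumTo-comm : ∀ n (g : I₀ → ℕ → ℤ) → Σ₆ (λ a → sumTo n (g a)) ≡ sumTo n (λ t → Σ₆ (λ a → g a t))
Σ₆-sumTo-comm zero    g = refl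
Σ₆-sumTo-comm (suc n) g =
  trans (sum-map-+ (λ a → sumTo n (g a)) (λ a → g a (suc n)) (allFin 6))
        (cong (_+ Σ₆ (λ a → g a (suc n))) (Σ₆-sumTo-comm n g))

sumTo-nonPos : ∀ n (f : ℕ → ℤ) → (∀ t → f t ℤ.≤ + 0) → sumTo n f ℤ.≤ + 0
sumTo-nonPos zero    f f≤0 = ℤP.≤-refl
sumTo-nonPos (suc n) f f≤0 = ℤP.+-mono-≤ (sumTo-nonPos n f f≤0) (f≤0 (suc n))

sumTo-nonPos-≤-term : ∀ n (f : ℕ → ℤ) → (∀ t → f t ℤ.≤ + 0) →
  ∀ {t} → 1 ≤ t → t ≤ n → sumTo n f ℤ.≤ f t
sumTo-nonPos-≤-term zero    f f≤0 1≤t t≤0 = ⊥-elim (ℕP.<⇒≱ 1≤t t≤0)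
sumTo-nonPos-≤-term (suc n) f f≤0 {t} 1≤t t≤1+n with t ℕP.≟ suc n
... | yes refl = ℤP.≤-trans (ℤP.+-monoˡ-≤ (f (suc n)) (sumTo-nonPos n f f≤0)) (ℤP.≤-reflexive (ℤP.+-identityˡ _))
... | no t≢1+n = ℤP.≤-trans
  (ℤP.+-mono-≤ (sumTo-nonPos-≤-term n f f≤0 1≤t (ℕP.≤-pred (ℕP.≤∧≢⇒< t≤1+n t≢1+n))) (f≤0 (suc n)))
  (ℤP.≤-reflexive (ℤP.+-identityʳ (f t)))

nonPos-terms-of-nonNeg-sum : ∀ n (f : ℕ → ℤ) → (∀ t → f t ℤ.≤ + 0) → + 0 ℤ.≤ sumTo n f →
  ∀ {t} → 1 ≤ t → t ≤ n → f t ≡ + 0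
nonPos-terms-of-nonNeg-sum n f f≤0 0≤sum 1≤t t≤n =
  ℤP.≤-antisym (f≤0 _) (ℤP.≤-trans 0≤sum (sumTo-nonPos-≤-term n f f≤0 1≤t t≤n))

last-before-failure : ∀ {P : ℕ → Set} → Decidable P → ∀ {t} n → P t → ¬ P (t ℕ.+ n) →
  ∃[ u ] (t ≤ u × P u × ¬ P (suc u))
last-before-failure {P} P? {t} zero    Pt ¬Pt+0 = ⊥-elim (¬Pt+0 (subst P (sym (ℕP.+-identityʳ t)) Pt))
last-before-failure {P} P? {t} (suc n) Pt ¬Pt+1+n with P? (suc t)
... | no ¬P1+t = t , ℕP.≤-refl , Pt , ¬P1+t
... | yes P1+t with u , 1+t≤u , Pu , ¬P1+u ← last-before-failure P? n P1+t (¬Pt+1+n ∘ subst P (sym (ℕP.+-suc t n)))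
  = u , ℕP.<⇒≤ 1+t≤u , Pu , ¬P1+u

All-≡⇒replicate : ∀ {A : Set} {x : A} xs → All (_≡ x) xs → xs ≡ replicate (length xs) x
All-≡⇒replicate []       []            = refl
All-≡⇒replicate (y ∷ ys) (y≡x ∷ ys≡x) = cong₂ _∷_ y≡x (All-≡⇒replicate ys ys≡x)

∈⇒length≢0 : ∀ {A : Set} {x : A} {xs} → x ∈ xs → length xs ≢ 0
∈⇒length≢0 (here _)  ()
∈⇒length≢0 (there _) ()

-- Column heights and vacancy numbers

𝟙[_≤_] : ℕ → ℕ → ℕ
𝟙[ zero  ≤ l     ] = 1
𝟙[ suc t ≤ zero  ] = 0
𝟙[ suc t ≤ suc l ] = 𝟙[ t ≤ l ]

𝟙-≤ : ∀ {t l} → t ≤ l → 𝟙[ t ≤ l ] ≡ 1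
𝟙-≤ z≤n       = refl
𝟙-≤ (s≤s t≤l) = 𝟙-≤ t≤l

𝟙-> : ∀ {t l} → l < t → 𝟙[ t ≤ l ] ≡ 0
𝟙-> {suc t} {zero}  _           = refl
𝟙-> {suc t} {suc l} (s≤s l<t) = 𝟙-> l<t

𝟙≤1 : ∀ t l → 𝟙[ t ≤ l ] ≤ 1
𝟙≤1 zero    l       = ℕP.≤-refl
𝟙≤1 (suc t) zero    = z≤n
𝟙≤1 (suc t) (suc l) = 𝟙≤1 t l

𝟙-suc-≤ : ∀ t l → 𝟙[ suc t ≤ l ] ≤ 𝟙[ t ≤ l ]
𝟙-suc-≤ zero    zero    = z≤n
𝟙-suc-≤ zero    (suc l) = ℕP.≤-refl
𝟙-suc-≤ (suc t) zero    = z≤n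
𝟙-suc-≤ (suc t) (suc l) = 𝟙-suc-≤ t l

𝟙-suc-≢ : ∀ t l → l ≢ t → 𝟙[ suc t ≤ l ] ≡ 𝟙[ t ≤ l ]
𝟙-suc-≢ zero    zero    l≢t = ⊥-elim (l≢t refl)
𝟙-suc-≢ zero    (suc l) _   = refl
𝟙-suc-≢ (suc t) zero    _   = refl
𝟙-suc-≢ (suc t) (suc l) l≢t = 𝟙-suc-≢ t l (l≢t ∘ cong suc)

⊓-suc : ∀ i l → suc i ℕ.⊓ l ≡ i ℕ.⊓ l ℕ.+ 𝟙[ suc i ≤ l ]
⊓-suc zero    zero    = refl
⊓-suc zero    (suc l) = refl
⊓-suc (suc i) zero    = refl
⊓-suc (suc i) (suc l) = cong suc (⊓-suc i l)

height : ℕ → List Row → ℕ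
height t []       = 0
height t (r ∷ rs) = 𝟙[ t ≤ proj₁ r ] ℕ.+ height t rs

height-suc-≤ : ∀ t rows → height (suc t) rows ≤ height t rows
height-suc-≤ t []       = z≤n
height-suc-≤ t (r ∷ rs) = ℕP.+-mono-≤ (𝟙-suc-≤ t (proj₁ r)) (height-suc-≤ t rs)

height-antitone : ∀ {t u} rows → t ≤ u → height u rows ≤ height t rows
height-antitone rows t≤u = go (ℕP.≤⇒≤′ t≤u)
  where
  go : ∀ {t u} → t ≤′ u → height u rows ≤ height t rows
  go ≤′-refl         = ℕP.≤-refl
  go (≤′-step t≤′u) = ℕP.≤-trans (height-suc-≤ _ rows) (go t≤′u)

height-beyond : ∀ t rows → All (λ r → proj₁ r < t) rows → height t rows ≡ 0
height-beyond t []       []           = refl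
height-beyond t (r ∷ rs) (len<t ∷ ps) = cong₂ ℕ._+_ (𝟙-> len<t) (height-beyond t rs ps)

height-one : ∀ rows → All (λ r → 1 ≤ proj₁ r) rows → height 1 rows ≡ length rows
height-one []       []           = refl
height-one (r ∷ rs) (1≤len ∷ ps) = cong₂ ℕ._+_ (𝟙-≤ 1≤len) (height-one rs ps)

height-drop⇒row : ∀ u rows → height (suc u) rows < height u rows → Any (λ r → proj₁ r ≡ u) rows
height-drop⇒row u (r ∷ rs) drop with proj₁ r ℕP.≟ u
... | yes len≡u = here len≡u
... | no  len≢u = there (height-drop⇒row u rs
        (ℕP.+-cancelˡ-< 𝟙[ u ≤ proj₁ r ] _ _
          (subst (λ i → i ℕ.+ height (suc u) rs < 𝟙[ u ≤ proj₁ r ] ℕ.+ height u rs) (𝟙-suc-≢ u (proj₁ r) len≢u) drop)))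

row⇒height-drop : ∀ u rows → Any (λ r → proj₁ r ≡ u) rows → height (suc u) rows < height u rows
row⇒height-drop u (r ∷ rs) (here refl)
  rewrite 𝟙-≤ (ℕP.≤-refl {proj₁ r}) | 𝟙-> (ℕP.n<1+n (proj₁ r)) = s≤s (height-suc-≤ u rs)
row⇒height-drop u (r ∷ rs) (there row) = ℕP.+-mono-≤-< (𝟙-suc-≤ u (proj₁ r)) (row⇒height-drop u rs row)

firstLength : List Row → ℕ
firstLength []      = 0
firstLength (r ∷ _) = proj₁ r

height-of-short : ∀ rows → length rows ≤ 1 → ∀ {t} → 1 ≤ t → height t rows ≡ 𝟙[ t ≤ firstLength rows ]
height-of-short []      _ 1≤t = sym (𝟙-> 1≤t)
height-of-short (r ∷ []) _ _  = ℕP.+-identityʳ _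
height-of-short (_ ∷ _ ∷ _) (s≤s ()) _

heights : RC → ℕ → I₀ → ℕ
heights rc t a = height t (rc a)

jump : ℤ → (I₀ → ℤ) → I₀ → ℤ
jump e x a = δ a node3 * e - Σ₆ (λ b → cartan a b * x b)

jump-cong : ∀ e {x y : I₀ → ℤ} → x ≗ y → ∀ a → jump e x a ≡ jump e y a
jump-cong e x≗y a = cong (_-_ (δ a node3 * e)) (Σ₆-cong λ b → cong (cartan a b *_) (x≗y b))

vacancyJump : ℕ → RC → I₀ → ℕ → ℤ
vacancyJump s rc a t = jump (+ 𝟙[ t ≤ s ]) (+_ ∘ heights rc t) a

Q-zero : ∀ rows → Q 0 rows ≡ + 0
Q-zero []       = refl
Q-zero (r ∷ rs) = cong₂ _+_ (cong +_ (ℕP.⊓-zeroˡ (proj₁ r))) (Q-zero rs)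

Q-suc : ∀ i rows → Q (suc i) rows ≡ Q i rows + + height (suc i) rows
Q-suc i []       = refl
Q-suc i (r ∷ rs) = begin
  + (suc i ℕ.⊓ proj₁ r) + Q (suc i) rs
    ≡⟨ cong₂ (λ m q → + m + q) (⊓-suc i (proj₁ r)) (Q-suc i rs) ⟩
  (+ (i ℕ.⊓ proj₁ r) + + 𝟙[ suc i ≤ proj₁ r ]) + (Q i rs + + height (suc i) rs)
    ≡⟨ interchange (+ (i ℕ.⊓ proj₁ r)) (+ 𝟙[ suc i ≤ proj₁ r ]) (Q i rs) (+ height (suc i) rs) ⟩
  Q i (r ∷ rs) + + height (suc i) (r ∷ rs) ∎
  where open ≡-Reasoning

vacancy-suc : ∀ s rc a i → vacancy s rc a (suc i) ≡ vacancy s rc a i + vacancyJump s rc a (suc i)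
vacancy-suc s rc a i = begin
  δ₃ * + (suc i ℕ.⊓ s) - Σ₆ (λ b → cartan a b * Q (suc i) (rc b))
    ≡⟨ cong₂ (λ m q → δ₃ * + m - q) (⊓-suc i s) (trans (Σ₆-cong split-Q) (sum-map-+ old new (allFin 6))) ⟩
  δ₃ * (+ (i ℕ.⊓ s) + + 𝟙[ suc i ≤ s ]) - (Σ₆ old + Σ₆ new)
    ≡⟨ split δ₃ (+ (i ℕ.⊓ s)) (+ 𝟙[ suc i ≤ s ]) (Σ₆ old) (Σ₆ new) ⟩
  vacancy s rc a i + vacancyJump s rc a (suc i) ∎
  where
  open ≡-Reasoning
  δ₃ = δ a node3
  old new : I₀ → ℤ
  old b = cartan a b * Q i (rc b)
  new b = cartan a b * + heights rc (suc i) b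
  split-Q : ∀ b → cartan a b * Q (suc i) (rc b) ≡ old b + new b
  split-Q b = trans (cong (cartan a b *_) (Q-suc i (rc b))) (ℤP.*-distribˡ-+ (cartan a b) _ _)
  split : ∀ d x y S T → d * (x + y) - (S + T) ≡ (d * x - S) + (d * y - T)
  split = solve-∀

vacancy≡sumTo : ∀ s rc a i → vacancy s rc a i ≡ sumTo i (vacancyJump s rc a)
vacancy≡sumTo s rc a zero = cong₂ _-_ (ℤP.*-zeroʳ (δ a node3))
  (Σ₆-cong λ b → trans (cong (cartan a b *_) (Q-zero (rc b))) (ℤP.*-zeroʳ (cartan a b)))
vacancy≡sumTo s rc a (suc i) = trans (vacancy-suc s rc a i) (cong (_+ vacancyJump s rc a (suc i)) (vacancy≡sumTo s rc a i))

sumTo-𝟙 : ∀ {l N} (f : ℕ → ℤ) → l ≤ N → sumTo N (λ t → + 𝟙[ t ≤ l ] * f t) ≡ sumTo l f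
sumTo-𝟙 {l} f l≤N = go (ℕP.≤⇒≤′ l≤N)
  where
  open ≡-Reasoning
  go : ∀ {N} → l ≤′ N → sumTo N (λ t → + 𝟙[ t ≤ l ] * f t) ≡ sumTo l f
  go ≤′-refl = sumTo-cong l λ {t} _ t≤l → trans (cong (λ m → + m * f t) (𝟙-≤ t≤l)) (ℤP.*-identityˡ (f t))
  go (≤′-step {N} l≤′N) = begin
    sumTo N (λ t → + 𝟙[ t ≤ l ] * f t) + + 𝟙[ suc N ≤ l ] * f (suc N)
      ≡⟨ cong₂ _+_ (go l≤′N) (cong (λ m → + m * f (suc N)) (𝟙-> (s≤s (ℕP.≤′⇒≤ l≤′N)))) ⟩
    sumTo l f + + 0 * f (suc N)
      ≡⟨ ℤP.+-identityʳ (sumTo l f) ⟩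
    sumTo l f ∎

sum-rows-sumTo : ∀ (f : ℕ → ℤ) {N} rows → All (λ r → proj₁ r ≤ N) rows →
  sum (map (λ r → sumTo (proj₁ r) f) rows) ≡ sumTo N (λ t → + height t rows * f t)
sum-rows-sumTo f {N} []       []            = sym (begin
  sumTo N (λ t → + 0 * f t) ≡⟨ sumTo-cong N (λ {t} _ _ → ℤP.*-zeroˡ (f t)) ⟩
  sumTo N (λ _ → + 0)       ≡⟨ sumTo-const N (+ 0) ⟩
  + N * + 0                 ≡⟨ ℤP.*-zeroʳ (+ N) ⟩
  + 0                       ∎)
  where open ≡-Reasoning
sum-rows-sumTo f {N} (r ∷ rs) (len≤N ∷ ps) = begin
  sumTo (proj₁ r) f + sum (map (λ r → sumTo (proj₁ r) f) rs)
    ≡⟨ cong₂ _+_ (sumTo-𝟙 f len≤N) (sym (sum-rows-sumTo f rs ps)) ⟨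
  sumTo N (λ t → + 𝟙[ t ≤ proj₁ r ] * f t) + sumTo N (λ t → + height t rs * f t)
    ≡⟨ sumTo-+ N _ _ ⟨
  sumTo N (λ t → + 𝟙[ t ≤ proj₁ r ] * f t + + height t rs * f t)
    ≡⟨ sumTo-cong N (λ {t} _ _ → ℤP.*-distribʳ-+ (f t) (+ 𝟙[ t ≤ proj₁ r ]) (+ height t rs)) ⟨
  sumTo N (λ t → + height t (r ∷ rs) * f t) ∎
  where open ≡-Reasoning

totalVacancy : ℕ → RC → ℤ
totalVacancy s rc = Σ₆ (λ a → sum (map (λ r → vacancy s rc a (proj₁ r)) (rc a)))

-- The column contribution e·x₃ − xᵀAx and the sum-of-squares certificates
-- below are written once over any `Arithmetic`; read in ℤ they are the
-- quantities of the proof, read as solver syntax their identities are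
-- checked by the ring solver.
record Arithmetic (A : Set) : Set where
  infixl 6 _⊕_ _⊖_
  infixl 7 _⊗_
  field
    _⊕_ _⊖_ _⊗_ : A → A → A
    const       : ℤ → A

open Arithmetic {{...}}

instance
  ℤ-arithmetic : Arithmetic ℤ
  ℤ-arithmetic = record { _⊕_ = _+_ ; _⊖_ = _-_ ; _⊗_ = _*_ ; const = λ z → z }

  syntax-arithmetic : ∀ {n} → Arithmetic (+-*-Solver.Polynomial n)
  syntax-arithmetic = record { _⊕_ = +-*-Solver._:+_ ; _⊖_ = +-*-Solver._:-_ ; _⊗_ = +-*-Solver._:*_ ; const = +-*-Solver.con }

⌜_⌝ : ∀ {A} {{_ : Arithmetic A}} → ℕ → A
⌜ n ⌝ = const (+ n)

sum₆ : ∀ {A} {{_ : Arithmetic A}} → (I₀ → A) → A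
sum₆ f = List.foldr _⊕_ ⌜ 0 ⌝ (map f (allFin 6))

contribution : ∀ {A} {{_ : Arithmetic A}} → A → (I₀ → A) → A
contribution e x = sum₆ (λ a → x a ⊗ (const (δ a node3) ⊗ e ⊖ sum₆ (λ b → const (cartan a b) ⊗ x b)))

totalVacancy≡sumTo : ∀ s rc {N} → (∀ a → All (λ r → proj₁ r ≤ N) (rc a)) →
  totalVacancy s rc ≡ sumTo N (λ t → contribution (+ 𝟙[ t ≤ s ]) (+_ ∘ heights rc t))
totalVacancy≡sumTo s rc {N} bounded = begin
  totalVacancy s rc
    ≡⟨ Σ₆-cong (λ a → trans (cong sum (map-cong (λ r → vacancy≡sumTo s rc a (proj₁ r)) (rc a)))
                            (sum-rows-sumTo (vacancyJump s rc a) (rc a) (bounded a))) ⟩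
  Σ₆ (λ a → sumTo N (λ t → + heights rc t a * vacancyJump s rc a t))
    ≡⟨ Σ₆-sumTo-comm N (λ a t → + heights rc t a * vacancyJump s rc a t) ⟩
  sumTo N (λ t → contribution (+ 𝟙[ t ≤ s ]) (+_ ∘ heights rc t)) ∎
  where open ≡-Reasoning

totalVacancy-nonNeg : ∀ s rc → IsHWRC s rc → + 0 ℤ.≤ totalVacancy s rc
totalVacancy-nonNeg s rc (rigging≤vacancy , rigging≥0) =
  sum-map-nonNeg _ {allFin 6} (All.tabulate λ {a} _ → sum-map-nonNeg _ {rc a}
    (All.zipWith (λ ((_ , x≤p) , 0≤x) → ℤP.≤-trans 0≤x x≤p) (rigging≤vacancy a , rigging≥0 a)))

node1 node2 node4 node5 : I₀
node1 = zero
node2 = suc zero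
node4 = suc (suc (suc zero))
node5 = suc (suc (suc (suc zero)))

vec₆ : {A : Set} → A → A → A → A → A → A → I₀ → A
vec₆ x₁ x₂ x₃ x₄ x₅ x₆ zero = x₁
vec₆ x₁ x₂ x₃ x₄ x₅ x₆ (suc zero) = x₂
vec₆ x₁ x₂ x₃ x₄ x₅ x₆ (suc (suc zero)) = x₃
vec₆ x₁ x₂ x₃ x₄ x₅ x₆ (suc (suc (suc zero))) = x₄
vec₆ x₁ x₂ x₃ x₄ x₅ x₆ (suc (suc (suc (suc zero)))) = x₅
vec₆ x₁ x₂ x₃ x₄ x₅ x₆ (suc (suc (suc (suc (suc zero))))) = x₆

vec₆-η : ∀ {A : Set} (c : I₀ → A) → c ≗ vec₆ (c node1) (c node2) (c node3) (c node4) (c node5) (c node6)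
vec₆-η c zero                                = refl
vec₆-η c (suc zero)                          = refl
vec₆-η c (suc (suc zero))                    = refl
vec₆-η c (suc (suc (suc zero)))              = refl
vec₆-η c (suc (suc (suc (suc zero))))        = refl
vec₆-η c (suc (suc (suc (suc (suc zero))))) = refl

-- Opaque, so that unification can recover ts from squares ts.
opaque
  squares : ∀ {A} {{_ : Arithmetic A}} → List (ℕ × A) → A
  squares ts = List.foldr _⊕_ ⌜ 0 ⌝ (map (λ (w , y) → ⌜ w ⌝ ⊗ (y ⊗ y)) ts)

SumOfSquares : Set₁
SumOfSquares = ∀ {A} {{_ : Arithmetic A}} → A → A → A → A → A → A → List (ℕ × A)

Certificate : ℕ → ℕ → SumOfSquares → Set
Certificate W C sos = ∀ x₁ x₂ x₃ x₄ x₅ x₆ →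
  + W * - contribution (+ 1) (vec₆ x₁ x₂ x₃ x₄ x₅ x₆) + + C ≡ squares (sos x₁ x₂ x₃ x₄ x₅ x₆)

-- The first square of sosᵢ involves xᵢ alone; where the contribution
-- vanishes it is bounded by C, and this bounds xᵢ.
sos₁ : SumOfSquares
sos₁ x₁ x₂ x₃ x₄ x₅ x₆ =
    (1 , ⌜ 6 ⌝ ⊗ x₁ ⊖ ⌜ 5 ⌝)
  ∷ (24 , ⌜ 2 ⌝ ⊗ x₂ ⊖ x₄)
  ∷ (6 , ⌜ 4 ⌝ ⊗ x₃ ⊖ ⌜ 2 ⌝ ⊗ x₁ ⊖ ⌜ 2 ⌝ ⊗ x₄ ⊖ ⌜ 1 ⌝)
  ∷ (3 , ⌜ 4 ⌝ ⊗ x₄ ⊖ ⌜ 2 ⌝ ⊗ x₁ ⊖ ⌜ 4 ⌝ ⊗ x₅ ⊖ ⌜ 1 ⌝)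
  ∷ (3 , ⌜ 4 ⌝ ⊗ x₅ ⊖ ⌜ 2 ⌝ ⊗ x₁ ⊖ ⌜ 4 ⌝ ⊗ x₆ ⊖ ⌜ 1 ⌝)
  ∷ (3 , ⌜ 4 ⌝ ⊗ x₆ ⊖ ⌜ 2 ⌝ ⊗ x₁ ⊖ ⌜ 1 ⌝)
  ∷ []

sos₂ : SumOfSquares
sos₂ x₁ x₂ x₃ x₄ x₅ x₆ =
    (30 , ⌜ 1 ⌝ ⊗ x₂ ⊖ ⌜ 1 ⌝)
  ∷ (30 , ⌜ 2 ⌝ ⊗ x₁ ⊖ x₃)
  ∷ (10 , ⌜ 3 ⌝ ⊗ x₃ ⊖ ⌜ 2 ⌝ ⊗ x₄ ⊖ ⌜ 1 ⌝)
  ∷ (5 , ⌜ 4 ⌝ ⊗ x₄ ⊖ ⌜ 3 ⌝ ⊗ x₂ ⊖ ⌜ 3 ⌝ ⊗ x₅ ⊖ ⌜ 1 ⌝)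
  ∷ (3 , ⌜ 5 ⌝ ⊗ x₅ ⊖ ⌜ 3 ⌝ ⊗ x₂ ⊖ ⌜ 4 ⌝ ⊗ x₆ ⊖ ⌜ 1 ⌝)
  ∷ (2 , ⌜ 6 ⌝ ⊗ x₆ ⊖ ⌜ 3 ⌝ ⊗ x₂ ⊖ ⌜ 1 ⌝)
  ∷ []

sos₃ : SumOfSquares
sos₃ x₁ x₂ x₃ x₄ x₅ x₆ =
    (2 , ⌜ 3 ⌝ ⊗ x₃ ⊖ ⌜ 5 ⌝)
  ∷ (30 , ⌜ 2 ⌝ ⊗ x₁ ⊖ x₃)
  ∷ (30 , ⌜ 2 ⌝ ⊗ x₂ ⊖ x₄)
  ∷ (10 , ⌜ 3 ⌝ ⊗ x₄ ⊖ ⌜ 2 ⌝ ⊗ x₃ ⊖ ⌜ 2 ⌝ ⊗ x₅)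
  ∷ (5 , ⌜ 4 ⌝ ⊗ x₅ ⊖ ⌜ 2 ⌝ ⊗ x₃ ⊖ ⌜ 3 ⌝ ⊗ x₆)
  ∷ (3 , ⌜ 5 ⌝ ⊗ x₆ ⊖ ⌜ 2 ⌝ ⊗ x₃)
  ∷ []

sos₄ : SumOfSquares
sos₄ x₁ x₂ x₃ x₄ x₅ x₆ =
    (1 , ⌜ 1 ⌝ ⊗ x₄ ⊖ ⌜ 2 ⌝)
  ∷ (3 , ⌜ 2 ⌝ ⊗ x₁ ⊖ x₃)
  ∷ (3 , ⌜ 2 ⌝ ⊗ x₂ ⊖ x₄)
  ∷ (1 , ⌜ 3 ⌝ ⊗ x₃ ⊖ ⌜ 2 ⌝ ⊗ x₄ ⊖ ⌜ 1 ⌝)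
  ∷ (3 , ⌜ 2 ⌝ ⊗ x₅ ⊖ x₄ ⊖ x₆)
  ∷ (1 , ⌜ 3 ⌝ ⊗ x₆ ⊖ x₄)
  ∷ []

sos₅ : SumOfSquares
sos₅ x₁ x₂ x₃ x₄ x₅ x₆ =
    (1 , ⌜ 3 ⌝ ⊗ x₅ ⊖ ⌜ 4 ⌝)
  ∷ (15 , ⌜ 2 ⌝ ⊗ x₁ ⊖ x₃)
  ∷ (15 , ⌜ 2 ⌝ ⊗ x₂ ⊖ x₄)
  ∷ (5 , ⌜ 3 ⌝ ⊗ x₃ ⊖ ⌜ 2 ⌝ ⊗ x₄ ⊖ ⌜ 1 ⌝)
  ∷ (1 , ⌜ 5 ⌝ ⊗ x₄ ⊖ ⌜ 6 ⌝ ⊗ x₅ ⊖ ⌜ 2 ⌝)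
  ∷ (15 , ⌜ 2 ⌝ ⊗ x₆ ⊖ x₅)
  ∷ []

sos₆ : SumOfSquares
sos₆ x₁ x₂ x₃ x₄ x₅ x₆ =
    (5 , ⌜ 3 ⌝ ⊗ x₆ ⊖ ⌜ 2 ⌝)
  ∷ (30 , ⌜ 2 ⌝ ⊗ x₁ ⊖ x₃)
  ∷ (30 , ⌜ 2 ⌝ ⊗ x₂ ⊖ x₄)
  ∷ (10 , ⌜ 3 ⌝ ⊗ x₃ ⊖ ⌜ 2 ⌝ ⊗ x₄ ⊖ ⌜ 1 ⌝)
  ∷ (2 , ⌜ 5 ⌝ ⊗ x₄ ⊖ ⌜ 6 ⌝ ⊗ x₅ ⊖ ⌜ 2 ⌝)
  ∷ (3 , ⌜ 4 ⌝ ⊗ x₅ ⊖ ⌜ 5 ⌝ ⊗ x₆ ⊖ ⌜ 2 ⌝)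
  ∷ []

weighted-square-nonNeg : ∀ w y → + 0 ℤ.≤ + w * (y * y)
weighted-square-nonNeg w y = subst (+ 0 ℤ.≤_) (trans (ℤP.pos-* w _) (cong (+ w *_) (sym (square-abs y)))) (ℤ.+≤+ z≤n)
  where
  square-abs : ∀ y → y * y ≡ + (ℤ.∣ y ∣ ℕ.* ℤ.∣ y ∣)
  square-abs (+ n)    = sym (ℤP.pos-* n n)
  square-abs -[1+ n ] = refl

opaque
  unfolding squares
  open +-*-Solver using (Polynomial; solve; _:=_; con; _:+_; _:*_; :-_)

  squares-nonNeg : ∀ ts → + 0 ℤ.≤ squares ts
  squares-nonNeg ts = sum-map-nonNeg _ (All.universal (λ (w , y) → weighted-square-nonNeg w y) ts)

  squares-∷ : ∀ w y ts → squares ((w , y) ∷ ts) ≡ + w * (y * y) + squares ts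
  squares-∷ w y ts = refl

  certificate-claim : ℕ → ℕ → SumOfSquares → (x₁ x₂ x₃ x₄ x₅ x₆ : Polynomial 6) → Polynomial 6 × Polynomial 6
  certificate-claim W C sos x₁ x₂ x₃ x₄ x₅ x₆ =
    con (+ W) :* :- contribution (con (+ 1)) (vec₆ x₁ x₂ x₃ x₄ x₅ x₆) :+ con (+ C)
      := squares (sos x₁ x₂ x₃ x₄ x₅ x₆)

  certificate₁ : Certificate 48 40 sos₁
  certificate₁ = solve 6 (certificate-claim 48 40 sos₁) refl

  certificate₂ : Certificate 60 50 sos₂
  certificate₂ = solve 6 (certificate-claim 60 50 sos₂) refl

  certificate₃ : Certificate 60 50 sos₃
  certificate₃ = solve 6 (certificate-claim 60 50 sos₃) refl

  certificate₄ : Certificate 6 5 sos₄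
  certificate₄ = solve 6 (certificate-claim 6 5 sos₄) refl

  certificate₅ : Certificate 30 25 sos₅
  certificate₅ = solve 6 (certificate-claim 30 25 sos₅) refl

  certificate₆ : Certificate 60 50 sos₆
  certificate₆ = solve 6 (certificate-claim 60 50 sos₆) refl

nonNeg-if-≡squares : ∀ {z ts} → z ≡ squares ts → + 0 ℤ.≤ z
nonNeg-if-≡squares {ts = ts} z≡ = subst (+ 0 ℤ.≤_) (sym z≡) (squares-nonNeg ts)

-- For n > B the first square alone would already exceed C.
coordinate-bound : ∀ w m M {C} B n {rest} → squares ((w , + m * + n - + M) ∷ rest) ≡ + C →
  {{True (M ℕ.≤? m ℕ.* suc B)}} → {{True (C ℕ.<? w ℕ.* ((m ℕ.* suc B ∸ M) ℕ.* (m ℕ.* suc B ∸ M)))}} → n ≤ B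
coordinate-bound w m M {C} B n {rest} squares≡C {{M≤}} {{C<}} with n ℕP.≤? B
... | yes n≤B = n≤B
... | no  n≰B = ⊥-elim (ℕP.<⇒≱ (toWitness C<) (ℕP.≤-trans (ℕP.*-monoʳ-≤ w (ℕP.*-mono-≤ D≤k D≤k)) wk²≤C))
  where
  k = m ℕ.* n ∸ M
  m[1+B]≤mn : m ℕ.* suc B ≤ m ℕ.* n
  m[1+B]≤mn = ℕP.*-monoʳ-≤ m (ℕP.≰⇒> n≰B)
  D≤k : m ℕ.* suc B ∸ M ≤ k
  D≤k = ℕP.∸-monoˡ-≤ M m[1+B]≤mn
  d = + m * + n - + M
  difference : d ≡ + k
  difference = begin
    + m * + n - + M   ≡⟨ cong (_- + M) (ℤP.pos-* m n) ⟨
    + (m ℕ.* n) - + M ≡⟨ ℤP.m-n≡m⊖n (m ℕ.* n) M ⟩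
    m ℕ.* n ℤ.⊖ M     ≡⟨ ℤP.⊖-≥ (ℕP.≤-trans (toWitness M≤) m[1+B]≤mn) ⟩
    + k               ∎
    where open ≡-Reasoning
  wk²≤C : w ℕ.* (k ℕ.* k) ≤ C
  wk²≤C = ℤP.drop‿+≤+ (begin
    + (w ℕ.* (k ℕ.* k))                              ≡⟨ trans (ℤP.pos-* w _) (cong (+ w *_) (ℤP.pos-* k k)) ⟩
    + w * (+ k * + k)                                ≡⟨ ℤP.+-identityʳ _ ⟨
    + w * (+ k * + k) + + 0                          ≤⟨ ℤP.+-monoʳ-≤ (+ w * (+ k * + k)) (squares-nonNeg rest) ⟩
    + w * (+ k * + k) + squares rest                 ≡⟨ cong (λ e → + w * (e * e) + squares rest) difference ⟨
    + w * (d * d) + squares rest                     ≡⟨ squares-∷ w d rest ⟨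
    squares ((w , d) ∷ rest)                         ≡⟨ squares≡C ⟩
    + C                                              ∎)
    where open ℤP.≤-Reasoning

nonNeg-of-scaled : ∀ M C z → C < M → + 0 ℤ.≤ + M * z + + C → + 0 ℤ.≤ z
nonNeg-of-scaled M C (+ n)    _   _  = ℤ.+≤+ z≤n
nonNeg-of-scaled M C -[1+ n ] C<M 0≤ = ⊥-elim (ℤP.<⇒≱ negative 0≤)
  where
  open ℤP.≤-Reasoning
  rearrange : ∀ M C → M * -[1+ 0 ] + C ≡ C - M
  rearrange = solve-∀
  negative : + M * -[1+ n ] + + C ℤ.< + 0
  negative = begin-strict
    + M * -[1+ n ] + + C ≤⟨ ℤP.+-monoˡ-≤ (+ C) (ℤP.*-monoˡ-≤-nonNeg (+ M) (ℤ.-≤- z≤n)) ⟩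
    + M * -[1+ 0 ] + + C ≡⟨ rearrange (+ M) (+ C) ⟩
    + C - + M            ≡⟨ ℤP.m-n≡m⊖n C M ⟩
    C ℤ.⊖ M              ≡⟨ ℤP.⊖-< C<M ⟩
    - + (M ∸ C)          <⟨ ℤP.neg-mono-< (ℤ.+<+ (ℕP.m<n⇒0<n∸m C<M)) ⟩
    + 0                  ∎

contribution-one-nonPos : ∀ x → contribution (+ 1) x ℤ.≤ + 0
contribution-one-nonPos x =
  subst (ℤ._≤ + 0) (ℤP.neg-involutive _) (ℤP.neg-mono-≤ (nonNeg-of-scaled 6 5 _ ℕP.≤-refl 6φ+5≥0))
  where
  6φ+5≥0 : + 0 ℤ.≤ + 6 * - contribution (+ 1) x + + 5
  6φ+5≥0 = nonNeg-if-≡squares (certificate₄ (x node1) (x node2) (x node3) (x node4) (x node5) (x node6))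

contribution-zero-vec₆ : ∀ x₁ x₂ x₃ x₄ x₅ x₆ →
  contribution (+ 0) (vec₆ x₁ x₂ x₃ x₄ x₅ x₆) ≡ contribution (+ 1) (vec₆ x₁ x₂ x₃ x₄ x₅ x₆) - x₃
contribution-zero-vec₆ = solve 6 (λ x₁ x₂ x₃ x₄ x₅ x₆ →
    contribution (con (+ 0)) (vec₆ x₁ x₂ x₃ x₄ x₅ x₆)
      := contribution (con (+ 1)) (vec₆ x₁ x₂ x₃ x₄ x₅ x₆) :- x₃) refl
  where open +-*-Solver using (solve; _:=_; con; _:-_)

contribution-zero≡ : ∀ x → contribution (+ 0) x ≡ contribution (+ 1) x - x node3
contribution-zero≡ x = contribution-zero-vec₆ (x node1) (x node2) (x node3) (x node4) (x node5) (x node6)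

contribution-nonPos : ∀ {e} → e ≤ 1 → ∀ (c : I₀ → ℕ) → contribution (+ e) (+_ ∘ c) ℤ.≤ + 0
contribution-nonPos (s≤s z≤n) c = contribution-one-nonPos (+_ ∘ c)
contribution-nonPos z≤n       c = ℤP.≤-trans (ℤP.≤-reflexive (contribution-zero≡ (+_ ∘ c)))
                                  (ℤP.≤-trans (ℤP.i-j≤i _ (+ c node3)) (contribution-one-nonPos (+_ ∘ c)))

certificate-at-zero : ∀ W C {φ ts} → + W * - φ + + C ≡ squares ts → φ ≡ + 0 → squares ts ≡ + C
certificate-at-zero W C certificate refl =
  trans (sym certificate) (trans (cong (_+ + C) (ℤP.*-zeroʳ (+ W))) (ℤP.+-identityˡ (+ C)))

-- The numbers w m M given to coordinate-bound describe the first square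
-- (w , m xᵢ − M) of sosᵢ.
coordinate-bounds : ∀ n₁ n₂ n₃ n₄ n₅ n₆ →
  contribution (+ 1) (vec₆ (+ n₁) (+ n₂) (+ n₃) (+ n₄) (+ n₅) (+ n₆)) ≡ + 0 →
  n₁ ≤ 1 × n₂ ≤ 2 × n₃ ≤ 3 × n₄ ≤ 4 × n₅ ≤ 3 × n₆ ≤ 1
coordinate-bounds n₁ n₂ n₃ n₄ n₅ n₆ φ≡0 =
    coordinate-bound 1 6 5 1 n₁ (certificate-at-zero 48 40 (certificate₁ x₁ x₂ x₃ x₄ x₅ x₆) φ≡0)
  , coordinate-bound 30 1 1 2 n₂ (certificate-at-zero 60 50 (certificate₂ x₁ x₂ x₃ x₄ x₅ x₆) φ≡0)
  , coordinate-bound 2 3 5 3 n₃ (certificate-at-zero 60 50 (certificate₃ x₁ x₂ x₃ x₄ x₅ x₆) φ≡0)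
  , coordinate-bound 1 1 2 4 n₄ (certificate-at-zero 6 5 (certificate₄ x₁ x₂ x₃ x₄ x₅ x₆) φ≡0)
  , coordinate-bound 1 3 4 3 n₅ (certificate-at-zero 30 25 (certificate₅ x₁ x₂ x₃ x₄ x₅ x₆) φ≡0)
  , coordinate-bound 5 3 2 1 n₆ (certificate-at-zero 60 50 (certificate₆ x₁ x₂ x₃ x₄ x₅ x₆) φ≡0)
  where
  x₁ = + n₁; x₂ = + n₂; x₃ = + n₃; x₄ = + n₄; x₅ = + n₅; x₆ = + n₆

-- Columns of zero contribution

data Shape : Set where
  ∅ α α+α₆ α+α₆+α₅ α+α₆+α₅+α₄ α+α₆+α₅+α₄+α₂ : Shape

shape : Shape → I₀ → ℕ
shape ∅                 = λ _ → 0
shape α                 = cα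
shape α+α₆              = vec₆ 1 1 2 2 1 1
shape α+α₆+α₅           = vec₆ 1 1 2 2 2 1
shape α+α₆+α₅+α₄        = vec₆ 1 1 2 3 2 1
shape α+α₆+α₅+α₄+α₂     = vec₆ 1 2 2 3 2 1

shapes : List Shape
shapes = ∅ ∷ α ∷ α+α₆ ∷ α+α₆+α₅ ∷ α+α₆+α₅+α₄ ∷ α+α₆+α₅+α₄+α₂ ∷ []

HasShape : (I₀ → ℕ) → Set
HasShape c = Any (λ τ → c ≗ shape τ) shapes

_≗?_ : (c d : I₀ → ℕ) → Dec (c ≗ d)
c ≗? d = Dec.map′ (λ c≡d a → All.lookup c≡d (∈-allFin a)) (λ c≗d → All.tabulate λ {a} _ → c≗d a)
                 (All.all? (λ a → c a ℕP.≟ d a) (allFin 6))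

hasShape? : ∀ c → Dec (HasShape c)
hasShape? c = Any.any? (λ τ → c ≗? shape τ) shapes

ZeroColumnHasShape : ℕ → ℕ → ℕ → ℕ → ℕ → ℕ → Set
ZeroColumnHasShape n₁ n₂ n₃ n₄ n₅ n₆ =
  contribution (+ 1) (vec₆ (+ n₁) (+ n₂) (+ n₃) (+ n₄) (+ n₅) (+ n₆)) ≡ + 0 →
  HasShape (vec₆ n₁ n₂ n₃ n₄ n₅ n₆)

-- Opaque: later unfolding of the exhaustive check would be very slow.
opaque
  zero-columns-in-box : ∀ {n₁} → n₁ < 2 → ∀ {n₂} → n₂ < 3 → ∀ {n₃} → n₃ < 4 →
                        ∀ {n₄} → n₄ < 5 → ∀ {n₅} → n₅ < 4 → ∀ {n₆} → n₆ < 2 →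
                        ZeroColumnHasShape n₁ n₂ n₃ n₄ n₅ n₆
  zero-columns-in-box = toWitness {a? = ℕP.allUpTo? (λ n₁ → ℕP.allUpTo? (λ n₂ → ℕP.allUpTo? (λ n₃ →
    ℕP.allUpTo? (λ n₄ → ℕP.allUpTo? (λ n₅ → ℕP.allUpTo? (decide n₁ n₂ n₃ n₄ n₅) 2) 4) 5) 4) 3) 2} tt
    where
    decide : ∀ n₁ n₂ n₃ n₄ n₅ n₆ → Dec (ZeroColumnHasShape n₁ n₂ n₃ n₄ n₅ n₆)
    decide n₁ n₂ n₃ n₄ n₅ n₆ = (_ ℤP.≟ + 0) →-dec hasShape? (vec₆ n₁ n₂ n₃ n₄ n₅ n₆)

zero-column-shape : ∀ (c : I₀ → ℕ) → contribution (+ 1) (+_ ∘ c) ≡ + 0 → ∃[ τ ] c ≗ shape τ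
zero-column-shape c φ≡0
  with b₁ , b₂ , b₃ , b₄ , b₅ , b₆ ← coordinate-bounds (c node1) (c node2) (c node3) (c node4) (c node5) (c node6) φ≡0
  with τ , c≗τ ← Any.satisfied
                   (zero-columns-in-box (s≤s b₁) (s≤s b₂) (s≤s b₃) (s≤s b₄) (s≤s b₅) (s≤s b₆) φ≡0)
  = τ , λ a → trans (vec₆-η c a) (c≗τ a)

nonNeg-neg⇒zero : ∀ n → + 0 ℤ.≤ - + n → n ≡ 0
nonNeg-neg⇒zero zero    _  = refl
nonNeg-neg⇒zero (suc n) ()

shape-node3-zero : ∀ τ → shape τ node3 ≡ 0 → τ ≡ ∅
shape-node3-zero ∅ _ = refl

empty-column-shape : ∀ (c : I₀ → ℕ) → contribution (+ 0) (+_ ∘ c) ≡ + 0 → c ≗ shape ∅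
empty-column-shape c φ₀≡0 =
  subst (λ τ → c ≗ shape τ) (shape-node3-zero τ (trans (sym (c≗τ node3)) c₃≡0)) c≗τ
  where
  φ₀ = contribution (+ 0) (+_ ∘ c)
  φ₁ = contribution (+ 1) (+_ ∘ c)
  c₃≡0 : c node3 ≡ 0
  c₃≡0 = nonNeg-neg⇒zero (c node3) (begin
    + 0               ≡⟨ φ₀≡0 ⟨
    φ₀                ≡⟨ contribution-zero≡ (+_ ∘ c) ⟩
    φ₁ - + c node3    ≤⟨ ℤP.+-monoˡ-≤ (- + c node3) (contribution-one-nonPos (+_ ∘ c)) ⟩
    + 0 - + c node3   ≡⟨ ℤP.+-identityˡ (- + c node3) ⟩
    - + c node3       ∎)
    where open ℤP.≤-Reasoning
  φ₁≡0 : φ₁ ≡ + 0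
  φ₁≡0 = begin
    φ₁               ≡⟨ ℤP.+-identityʳ φ₁ ⟨
    φ₁ - + 0         ≡⟨ cong (λ n → φ₁ - + n) c₃≡0 ⟨
    φ₁ - + c node3   ≡⟨ contribution-zero≡ (+_ ∘ c) ⟨
    φ₀               ≡⟨ φ₀≡0 ⟩
    + 0              ∎
    where open ≡-Reasoning
  τ = proj₁ (zero-column-shape c φ₁≡0)
  c≗τ = proj₂ (zero-column-shape c φ₁≡0)

-- From the largest down, each of the four shapes other than ∅ and α is the
-- only one not yet excluded with h boxes at a node a, and has jump −1 there.
kill-node2 : ∀ τ → 2 ≤ shape τ node2 → jump (+ 1) (+_ ∘ shape τ) node2 ≡ -[1+ 0 ]
kill-node2 α+α₆+α₅+α₄+α₂ _ = refl
kill-node2 α                (s≤s ())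
kill-node2 α+α₆             (s≤s ())
kill-node2 α+α₆+α₅          (s≤s ())
kill-node2 α+α₆+α₅+α₄       (s≤s ())

kill-node4 : ∀ τ → shape τ node2 < 2 → 3 ≤ shape τ node4 → jump (+ 1) (+_ ∘ shape τ) node4 ≡ -[1+ 0 ]
kill-node4 α+α₆+α₅+α₄    _                    _ = refl
kill-node4 α+α₆+α₅+α₄+α₂ (s≤s (s≤s ()))       _
kill-node4 α             _ (s≤s (s≤s ()))
kill-node4 α+α₆          _ (s≤s (s≤s ()))
kill-node4 α+α₆+α₅       _ (s≤s (s≤s ()))

kill-node5 : ∀ τ → shape τ node4 < 3 → 2 ≤ shape τ node5 → jump (+ 1) (+_ ∘ shape τ) node5 ≡ -[1+ 0 ]
kill-node5 α+α₆+α₅       _                     _ = refl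
kill-node5 α+α₆+α₅+α₄    (s≤s (s≤s (s≤s ()))) _
kill-node5 α+α₆+α₅+α₄+α₂ (s≤s (s≤s (s≤s ()))) _
kill-node5 α             _ (s≤s ())
kill-node5 α+α₆          _ (s≤s ())

kill-node6 : ∀ τ → shape τ node5 < 2 → 1 ≤ shape τ node6 → jump (+ 1) (+_ ∘ shape τ) node6 ≡ -[1+ 0 ]
kill-node6 α+α₆          _              _ = refl
kill-node6 α+α₆+α₅       (s≤s (s≤s ())) _
kill-node6 α+α₆+α₅+α₄    (s≤s (s≤s ())) _
kill-node6 α+α₆+α₅+α₄+α₂ (s≤s (s≤s ())) _

survivors : ∀ τ → shape τ node6 < 1 → τ ≡ ∅ ⊎ τ ≡ α
survivors ∅                 _        = inj₁ refl
survivors α                 _        = inj₂ refl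
survivors α+α₆              (s≤s ())
survivors α+α₆+α₅           (s≤s ())
survivors α+α₆+α₅+α₄        (s≤s ())
survivors α+α₆+α₅+α₄+α₂     (s≤s ())

survivor-node1≤1 : ∀ {τ} → τ ≡ ∅ ⊎ τ ≡ α → shape τ node1 ≤ 1
survivor-node1≤1 (inj₁ refl) = z≤n
survivor-node1≤1 (inj₂ refl) = ℕP.≤-refl

-- Highest weight rigged configurations

cartan-α : ∀ a → Σ₆ (λ b → cartan a b * + cα b) ≡ δ a node3 - δ a node6
cartan-α zero                                = refl
cartan-α (suc zero)                          = refl
cartan-α (suc (suc zero))                    = refl
cartan-α (suc (suc (suc zero)))              = refl
cartan-α (suc (suc (suc (suc zero))))        = refl
cartan-α (suc (suc (suc (suc (suc zero))))) = refl

jump-α : ∀ a → jump (+ 1) (+_ ∘ cα) a ≡ δ a node6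
jump-α a = trans (cong (_-_ (δ a node3 * + 1)) (cartan-α a)) (cancel (δ a node3) (δ a node6))
  where
  cancel : ∀ d₃ d₆ → d₃ * + 1 - (d₃ - d₆) ≡ d₆
  cancel = solve-∀

δ-node6 : ∀ a → a ≡ node6 ⊎ δ a node6 ≡ + 0
δ-node6 a with a Fin.≟ node6
... | yes a≡6 = inj₁ a≡6
... | no  _   = inj₂ refl

module HighestWeight {s : ℕ} {rc : RC} (hw : IsHWRC s rc) where

  boxes : ℕ
  boxes = sumℕ (map (λ a → sumℕ (map proj₁ (rc a))) (allFin 6))

  row≤boxes : ∀ a → All (λ r → proj₁ r ≤ boxes) (rc a)
  row≤boxes a = All.tabulate λ r∈ →
    ℕP.≤-trans (∈⇒≤sum proj₁ r∈) (∈⇒≤sum (λ a → sumℕ (map proj₁ (rc a))) (∈-allFin a))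

  row≥1 : ∀ a → All (λ r → 1 ≤ proj₁ r) (rc a)
  row≥1 a = All.map proj₁ (proj₁ hw a)

  column-contribution-zero : ∀ {t e} → 1 ≤ t → 𝟙[ t ≤ s ] ≡ e → contribution (+ e) (+_ ∘ heights rc t) ≡ + 0
  column-contribution-zero {t} 1≤t refl =
    nonPos-terms-of-nonNeg-sum (boxes ℕ.+ t) _ (λ t → contribution-nonPos (𝟙≤1 t s) (heights rc t))
      (subst (+ 0 ℤ.≤_) (totalVacancy≡sumTo s rc rows≤) (totalVacancy-nonNeg s rc hw))
      1≤t (ℕP.m≤n+m t boxes)
    where
    rows≤ : ∀ a → All (λ r → proj₁ r ≤ boxes ℕ.+ t) (rc a)
    rows≤ a = All.map (λ r≤ → ℕP.≤-trans r≤ (ℕP.m≤m+n boxes t)) (row≤boxes a)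

  column : ∀ {t} → 1 ≤ t → ∃[ τ ] (heights rc t ≗ shape τ × (τ ≢ ∅ → t ≤ s))
  column {t} 1≤t with t ℕP.≤? s
  ... | yes t≤s =
    let τ , heights≗τ = zero-column-shape (heights rc t) (column-contribution-zero 1≤t (𝟙-≤ t≤s)) in τ , heights≗τ , λ _ → t≤s
  ... | no  t≰s =
    ∅ , empty-column-shape (heights rc t) (column-contribution-zero 1≤t (𝟙-> (ℕP.≰⇒> t≰s))) , λ ∅≢∅ → ⊥-elim (∅≢∅ refl)

  col : ∀ {t} → 1 ≤ t → Shape
  col p = proj₁ (column p)

  heights≗col : ∀ {t} (p : 1 ≤ t) → heights rc t ≗ shape (col p)
  heights≗col p = proj₁ (proj₂ (column p))

  vacancyJump-col : ∀ a {t} (p : 1 ≤ t) → col p ≢ ∅ → vacancyJump s rc a t ≡ jump (+ 1) (+_ ∘ shape (col p)) a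
  vacancyJump-col a {t} p col≢∅ =
    trans (cong (λ e → jump (+ e) (+_ ∘ heights rc t) a) (𝟙-≤ (proj₂ (proj₂ (column p)) col≢∅)))
          (jump-cong (+ 1) (cong +_ ∘ heights≗col p) a)

  beyond-boxes : ∀ a {h} → 1 ≤ h → ∀ t → ¬ (h ≤ heights rc (t ℕ.+ suc boxes) a)
  beyond-boxes a 1≤h t h≤hₜ = ℕP.<⇒≱ 1≤h (ℕP.≤-trans h≤hₜ (subst (heights rc (t ℕ.+ suc boxes) a ≤_)
    (height-beyond (suc boxes) (rc a) (All.map s≤s (row≤boxes a)))
    (height-antitone (rc a) (ℕP.m≤n+m (suc boxes) t))))

  row-vacancy-nonNeg : ∀ a {u} → Any (λ r → proj₁ r ≡ u) (rc a) → + 0 ℤ.≤ vacancy s rc a u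
  row-vacancy-nonNeg a row with ((_ , x≤p) , 0≤x) , len≡u ← All.lookupAny (All.zip (proj₁ hw a , proj₂ hw a)) row
    = ℤP.≤-trans 0≤x (ℤP.≤-trans x≤p (ℤP.≤-reflexive (cong (vacancy s rc a) len≡u)))

  -- If the vacancy drops by one in every column where ν^(a) has at least h
  -- boxes, the last such column ends a row of ν^(a) of negative vacancy.
  vacancy-chain : ∀ a {h} → 1 ≤ h → (∀ {t} → 1 ≤ t → h ≤ heights rc t a → vacancyJump s rc a t ≡ -[1+ 0 ]) →
    ∀ {t} → 1 ≤ t → heights rc t a < h
  vacancy-chain a {h} 1≤h drops {t} 1≤t with h ℕP.≤? heights rc t a
  ... | no  h≰ = ℕP.≰⇒> h≰
  ... | yes h≤
    with u , t≤u , h≤hᵤ , h≰hᵤ₊₁ ← last-before-failure (λ t → h ℕP.≤? heights rc t a) (suc boxes) h≤ (beyond-boxes a 1≤h t)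
    = ⊥-elim (ℤP.<⇒≱ (sumTo-negative (ℕP.≤-trans 1≤t t≤u)) (begin
        + 0
          ≤⟨ row-vacancy-nonNeg a (height-drop⇒row u (rc a) (ℕP.<-≤-trans (ℕP.≰⇒> h≰hᵤ₊₁) h≤hᵤ)) ⟩
        vacancy s rc a u
          ≡⟨ vacancy≡sumTo s rc a u ⟩
        sumTo u (vacancyJump s rc a)
          ≡⟨ sumTo-cong u (λ 1≤i i≤u → drops 1≤i (ℕP.≤-trans h≤hᵤ (height-antitone (rc a) i≤u))) ⟩
        sumTo u (λ _ → -[1+ 0 ])
          ∎))
    where open ℤP.≤-Reasoning

  eliminate : ∀ a {h} → 1 ≤ h →
    (∀ {t} (p : 1 ≤ t) → h ≤ shape (col p) a → jump (+ 1) (+_ ∘ shape (col p)) a ≡ -[1+ 0 ]) →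
    ∀ {t} (p : 1 ≤ t) → shape (col p) a < h
  eliminate a {h} 1≤h killed p = subst (_< h) (heights≗col p a) (vacancy-chain a 1≤h drops p)
    where
    drops : ∀ {t} → 1 ≤ t → h ≤ heights rc t a → vacancyJump s rc a t ≡ -[1+ 0 ]
    drops p′ h≤hₜ = trans (vacancyJump-col a p′ col≢∅) (killed p′ h≤τ)
      where
      h≤τ = subst (h ≤_) (heights≗col p′ a) h≤hₜ
      col≢∅ : col p′ ≢ ∅
      col≢∅ col≡∅ = ℕP.<⇒≱ 1≤h (subst (λ τ → h ≤ shape τ a) col≡∅ h≤τ)

  node2<2 : ∀ {t} (p : 1 ≤ t) → shape (col p) node2 < 2
  node2<2 = eliminate node2 (s≤s z≤n) (λ p → kill-node2 (col p))

  node4<3 : ∀ {t} (p : 1 ≤ t) → shape (col p) node4 < 3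
  node4<3 = eliminate node4 (s≤s z≤n) (λ p → kill-node4 (col p) (node2<2 p))

  node5<2 : ∀ {t} (p : 1 ≤ t) → shape (col p) node5 < 2
  node5<2 = eliminate node5 (s≤s z≤n) (λ p → kill-node5 (col p) (node4<3 p))

  node6<1 : ∀ {t} (p : 1 ≤ t) → shape (col p) node6 < 1
  node6<1 = eliminate node6 (s≤s z≤n) (λ p → kill-node6 (col p) (node5<2 p))

  col-∅-or-α : ∀ {t} (p : 1 ≤ t) → col p ≡ ∅ ⊎ col p ≡ α
  col-∅-or-α p = survivors (col p) (node6<1 p)

  l : ℕ
  l = firstLength (rc node1)

  node1-heights : ∀ {t} → 1 ≤ t → heights rc t node1 ≡ 𝟙[ t ≤ l ]
  node1-heights = height-of-short (rc node1) (begin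
    length (rc node1)         ≡⟨ height-one (rc node1) (row≥1 node1) ⟨
    heights rc 1 node1        ≡⟨ heights≗col (s≤s z≤n) node1 ⟩
    shape (col p₁) node1      ≤⟨ survivor-node1≤1 (col-∅-or-α p₁) ⟩
    1                         ∎)
    where
    open ℕP.≤-Reasoning
    p₁ : 1 ≤ 1
    p₁ = s≤s z≤n

  node1-height-one : ∀ {t} → 1 ≤ t → t ≤ l → heights rc t node1 ≡ 1
  node1-height-one p t≤l = trans (node1-heights p) (𝟙-≤ t≤l)

  row-count : ∀ a → length (rc a) ≡ heights rc 1 a
  row-count a = sym (height-one (rc a) (row≥1 a))

  α-column : ∀ {t} (p : 1 ≤ t) → t ≤ l → heights rc t ≗ cα
  α-column p t≤l with col p | col-∅-or-α p | heights≗col p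
  ... | _ | inj₂ refl | heights≗α = heights≗α
  ... | _ | inj₁ refl | heights≗∅ = ⊥-elim (ℕP.1+n≢0 (trans (sym (node1-height-one p t≤l)) (heights≗∅ node1)))

  ∅-column : ∀ {t} (p : 1 ≤ t) → l < t → heights rc t ≗ shape ∅
  ∅-column p l<t with col p | col-∅-or-α p | heights≗col p
  ... | _ | inj₁ refl | heights≗∅ = heights≗∅
  ... | _ | inj₂ refl | heights≗α = ⊥-elim (ℕP.1+n≢0 (trans (sym (heights≗α node1)) (trans (node1-heights p) (𝟙-> l<t))))

  ≤l⇒≤s : ∀ {t} → 1 ≤ t → t ≤ l → t ≤ s
  ≤l⇒≤s p t≤l = proj₂ (proj₂ (column p)) λ col≡∅ →
    ℕP.1+n≢0 (trans (sym (node1-height-one p t≤l)) (trans (heights≗col p node1) (cong (λ τ → shape τ node1) col≡∅)))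

  l≤s : l ≤ s
  l≤s with 1 ℕP.≤? l
  ... | yes 1≤l = ≤l⇒≤s 1≤l ℕP.≤-refl
  ... | no  1≰l = subst (_≤ s) (sym (ℕP.n<1⇒n≡0 (ℕP.≰⇒> 1≰l))) z≤n

  row-length : ∀ a {u} → 1 ≤ u → Any (λ r → proj₁ r ≡ u) (rc a) → u ≡ l
  row-length a {u} 1≤u row with ℕP.<-cmp u l
  ... | tri≈ _ u≡l _ = u≡l
  ... | tri< u<l _ _ = ⊥-elim (ℕP.<-irrefl (trans (α-column (s≤s z≤n) u<l a) (sym (α-column 1≤u (ℕP.<⇒≤ u<l) a)))
                                           (row⇒height-drop u (rc a) row))
  ... | tri> _ _ l<u =
    ⊥-elim (ℕP.n≮0 (subst (heights rc (suc u) a <_) (∅-column 1≤u l<u a) (row⇒height-drop u (rc a) row)))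

  vacancy-at-l : ∀ a → vacancy s rc a l ≡ + l * δ a node6
  vacancy-at-l a = trans (vacancy≡sumTo s rc a l) (trans (sumTo-cong l jump≡) (sumTo-const l (δ a node6)))
    where
    jump≡ : ∀ {t} → 1 ≤ t → t ≤ l → vacancyJump s rc a t ≡ δ a node6
    jump≡ {t} p t≤l = trans (cong (λ e → jump (+ e) (+_ ∘ heights rc t) a) (𝟙-≤ (≤l⇒≤s p t≤l)))
                            (trans (jump-cong (+ 1) (cong +_ ∘ α-column p t≤l) a) (jump-α a))

  node6-empty : length (rc node6) ≡ 0
  node6-empty = ℕP.n<1⇒n≡0 (subst (_< 1) (sym (trans (row-count node6) (heights≗col p₁ node6))) (node6<1 p₁))
    where
    p₁ : 1 ≤ 1
    p₁ = s≤s z≤n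

  row≡ : ∀ a {r} → r ∈ rc a → r ≡ (l , + 0)
  row≡ a {r} r∈ = cong₂ _,_ len≡l rigging≡0
    where
    x≤p = proj₂ (All.lookup (proj₁ hw a) r∈)
    len≡l : proj₁ r ≡ l
    len≡l = row-length a (proj₁ (All.lookup (proj₁ hw a) r∈)) (Any.map (λ r≡r′ → cong proj₁ (sym r≡r′)) r∈)
    rigging≡0 : proj₂ r ≡ + 0
    rigging≡0 with δ-node6 a
    ... | inj₁ refl = ⊥-elim (∈⇒length≢0 r∈ node6-empty)
    ... | inj₂ δ≡0  = ℤP.≤-antisym (ℤP.≤-trans x≤p (ℤP.≤-reflexive (begin
      vacancy s rc a (proj₁ r) ≡⟨ cong (vacancy s rc a) len≡l ⟩
      vacancy s rc a l         ≡⟨ vacancy-at-l a ⟩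
      + l * δ a node6          ≡⟨ cong (+ l *_) δ≡0 ⟩
      + l * + 0                ≡⟨ ℤP.*-zeroʳ (+ l) ⟩
      + 0                      ∎))) (All.lookup (proj₂ hw a) r∈)
      where open ≡-Reasoning

  classification : ∃[ k ] (k ≤ s × rc ≈RC νkα k)
  classification = l , l≤s , λ a →
    ↭-reflexive (trans (All-≡⇒replicate (rc a) (All.tabulate (row≡ a))) (replicate≡νkα l refl a))
    where
    replicate≡νkα : ∀ k → l ≡ k → ∀ a → replicate (length (rc a)) (l , + 0) ≡ νkα k a
    replicate≡νkα zero    l≡0 a = cong (λ n → replicate n (l , + 0))
      (trans (row-count a) (∅-column (s≤s z≤n) (subst (_< 1) (sym l≡0) (s≤s z≤n)) a))
    replicate≡νkα (suc k) l≡1+k a = cong₂ (λ n m → replicate n (m , + 0))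
      (trans (row-count a) (α-column (s≤s z≤n) (subst (1 ≤_) (sym l≡1+k) (s≤s z≤n)) a)) l≡1+k

-- The rigged configurations ν(k ∗ [α])

Q-replicate : ∀ i n l x → Q i (replicate n (l , x)) ≡ + n * + (i ℕ.⊓ l)
Q-replicate i n l x = trans (cong sum (map-replicate (λ row → + (i ℕ.⊓ proj₁ row)) n (l , x))) (sum-replicate n _)

Σ₆-cartan-cα : ∀ a K → Σ₆ (λ b → cartan a b * (+ cα b * K)) ≡ (δ a node3 - δ a node6) * K
Σ₆-cartan-cα a K = begin
  Σ₆ (λ b → cartan a b * (+ cα b * K)) ≡⟨ Σ₆-cong (λ b → ℤP.*-assoc (cartan a b) (+ cα b) K) ⟨
  Σ₆ (λ b → cartan a b * + cα b * K)   ≡⟨ sum-map-*ʳ (λ b → cartan a b * + cα b) K (allFin 6) ⟩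
  Σ₆ (λ b → cartan a b * + cα b) * K   ≡⟨ cong (_* K) (cartan-α a) ⟩
  (δ a node3 - δ a node6) * K          ∎
  where open ≡-Reasoning

size-νkα : ∀ k a → size (νkα k a) ≡ + cα a * + k
size-νkα zero    a = sym (ℤP.*-zeroʳ (+ cα a))
size-νkα (suc k) a = trans (cong sum (map-replicate (λ row → + proj₁ row) (cα a) _)) (sum-replicate (cα a) (+ suc k))

weight-νkα : ∀ s k b → weight s (νkα k) b ≡ targetWeight s k b
weight-νkα s k b = begin
  δ b node3 * + s - Σ₆ (λ a → cartan b a * size (νkα k a))
    ≡⟨ cong (_-_ (δ b node3 * + s)) (trans (Σ₆-cong λ a → cong (cartan b a *_) (size-νkα k a)) (Σ₆-cartan-cα b (+ k))) ⟩
  δ b node3 * + s - (δ b node3 - δ b node6) * + k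
    ≡⟨ rearrange (δ b node3) (δ b node6) (+ s) (+ k) ⟩
  targetWeight s k b ∎
  where
  open ≡-Reasoning
  rearrange : ∀ d₃ d₆ S K → d₃ * S - (d₃ - d₆) * K ≡ d₃ * (S - K) + d₆ * K
  rearrange = solve-∀

δ*-nonNeg : ∀ a b n → + 0 ℤ.≤ δ a b * + n
δ*-nonNeg a b n with a Fin.≟ b
... | yes _ = subst (+ 0 ℤ.≤_) (sym (ℤP.*-identityˡ (+ n))) (ℤ.+≤+ z≤n)
... | no  _ = ℤ.+≤+ z≤n

vacancy-νkα : ∀ s k → suc k ≤ s → ∀ a → vacancy s (νkα (suc k)) a (suc k) ≡ δ a node6 * + suc k
vacancy-νkα s k 1+k≤s a = begin
  δ a node3 * + (suc k ℕ.⊓ s) - Σ₆ (λ b → cartan a b * Q (suc k) (νkα (suc k) b))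
    ≡⟨ cong₂ (λ m q → δ a node3 * + m - q) (ℕP.m≤n⇒m⊓n≡m 1+k≤s) (Σ₆-cong λ b → cong (cartan a b *_)
         (trans (Q-replicate (suc k) (cα b) (suc k) (+ 0)) (cong (λ m → + cα b * + m) (ℕP.⊓-idem (suc k))))) ⟩
  δ a node3 * + suc k - Σ₆ (λ b → cartan a b * (+ cα b * + suc k))
    ≡⟨ cong (_-_ (δ a node3 * + suc k)) (Σ₆-cartan-cα a (+ suc k)) ⟩
  δ a node3 * + suc k - (δ a node3 - δ a node6) * + suc k
    ≡⟨ cancel (δ a node3) (δ a node6) (+ suc k) ⟩
  δ a node6 * + suc k ∎
  where
  open ≡-Reasoning
  cancel : ∀ d₃ d₆ K → d₃ * K - (d₃ - d₆) * K ≡ d₆ * K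
  cancel = solve-∀

isHW-νkα : ∀ s k → k ≤ s → IsHWRC s (νkα k)
isHW-νkα s zero    _     = (λ _ → []) , (λ _ → [])
isHW-νkα s (suc k) 1+k≤s =
    (λ a → AllP.replicate⁺ (cα a)
      (s≤s z≤n , subst (+ 0 ℤ.≤_) (sym (vacancy-νkα s k 1+k≤s a)) (δ*-nonNeg a node6 (suc k))))
  , (λ a → AllP.replicate⁺ (cα a) (ℤ.+≤+ z≤n))

pairSum-replicate : ∀ m n l → pairSum (replicate m (l , + 0)) (replicate n (l , + 0)) ≡ + m * (+ n * + l)
pairSum-replicate m n l = begin
  sum (map (λ r → Q (proj₁ r) (replicate n (l , + 0))) (replicate m (l , + 0)))
    ≡⟨ cong sum (map-replicate (λ r → Q (proj₁ r) (replicate n (l , + 0))) m (l , + 0)) ⟩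
  sum (replicate m (Q l (replicate n (l , + 0))))
    ≡⟨ sum-replicate m _ ⟩
  + m * Q l (replicate n (l , + 0))
    ≡⟨ cong (+ m *_) (trans (Q-replicate l n l (+ 0)) (cong (λ i → + n * + i) (ℕP.⊓-idem l))) ⟩
  + m * (+ n * + l) ∎
  where open ≡-Reasoning

-- (α, α) = 2, as α is a root.
cartan-form-α : ∀ K → Σ₆ (λ a → Σ₆ (λ b → cartan a b * (+ cα a * (+ cα b * K)))) ≡ K * + 2
cartan-form-α = solve 1 (λ K →
  sum₆ (λ a → sum₆ (λ b → con (cartan a b) :* (con (+ cα a) :* (con (+ cα b) :* K)))) := K :* con (+ 2)) refl
  where open +-*-Solver using (solve; _:=_; con; _:*_)

cocharge-νkα : ∀ k → cocharge (νkα k) ≡ + k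
cocharge-νkα zero    = refl
cocharge-νkα (suc k) = begin
  Σ₆ (λ a → Σ₆ (λ b → cartan a b * pairSum (νkα (suc k) a) (νkα (suc k) b))) /ℕ 2 + + 0
    ≡⟨ cong (λ z → z /ℕ 2 + + 0) (trans
         (Σ₆-cong λ a → Σ₆-cong λ b → cong (cartan a b *_) (pairSum-replicate (cα a) (cα b) (suc k)))
         (cartan-form-α (+ suc k))) ⟩
  + (suc k ℕ.* 2) /ℕ 2 + + 0
    ≡⟨ ℤP.+-identityʳ _ ⟩
  + (suc k ℕ.* 2 ℕ./ 2)
    ≡⟨ cong +_ (DivMod.m*n/n≡m (suc k) 2) ⟩
  + suc k ∎
  where open ≡-Reasoning

proposition9p5 : (s : ℕ) → 1 ≤ s →
    ((rc : RC) → IsHWRC s rc → ∃[ k ] (k ≤ s × rc ≈RC νkα k))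
    × ((k : ℕ) → k ≤ s →
        IsHWRC s (νkα k)
        × (∀ b → weight s (νkα k) b ≡ targetWeight s k b)
        × cocharge (νkα k) ≡ + k)
proposition9p5 s _ =
    (λ rc hw → HighestWeight.classification hw)
  , (λ k k≤s → isHW-νkα s k k≤s , weight-νkα s k , cocharge-νkα k)
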